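{- Let $n\ge 2$, $k=\lfloor n/2\rfloor$, and let $f$ be the Boolean function of $x_1,\ldots,x_n$ with $f(x)=1\iff x_1+\cdots+x_n\ge k+1$. For each $k$-element subset $S\subseteq\{1,\ldots,n\}$ let $f_S(x)=1\iff \sum_{i=1}^n x_i+\frac1{2k}\sum_{i\in S}x_i\ge k+\frac12$ (so $f_S$ differs from $f$ exactly on the indicator vector of $S$). Let $\mathcal K_n=\{f\}\cup\{f_S: S\subseteq\{1,\ldots,n\},\ |S|=k\}$. Then for the problem of exactly identifying an unknown target function from $\mathcal K_n$: (a) it can be solved with a single equivalence query; (b) every deterministic algorithm using only membership and subcube identity queries that solves it must ask at least $\binom{n}{k}$ queries in the worst case.
   Context: A partial assignment $p$ to $\{x_1,\ldots,x_n\}$ is a map to $\{0,1,*\}$; the projection $g_p$ is the function of the variables $p^{ -1}(*)$ obtained by fixing the other variables to their values under $p$. A membership query takes a total assignment $a$ and returns $g(a)$ for the unknown target $g$; a subcube identity query takes a partial assignment $p$ and returns "yes" iff $g_p\equiv0$ or $g_p\equiv1$, and "no" otherwise; an equivalence query takes a hypothesis function $h$ and returns "yes" if $g\equiv h$, and otherwise a vector $y$ with $g(y)\ne h(y)$. Exact identification: the algorithm knows the class $\mathcal K_n$, adaptively asks queries about the unknown $g\in\mathcal K_n$, and must determine $g$. -}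

module Defs where

open import Data.Bool using (Bool; true; false; _∧_; if_then_else_)
open import Data.Nat using (ℕ; zero; suc; _+_; _*_; _≤_; _≤ᵇ_; _/_)
open import Data.Fin using (Fin; zero; suc)
open import Data.Fin.Subset using (Subset; ∣_∣)
open import Data.Vec using (lookup)
open import Data.Maybe using (Maybe; just; nothing)
open import Data.Product using (Σ; _×_)
open import Data.Sum using (_⊎_)
open import Relation.Binary.PropositionalEquality using (_≡_; _≢_)
open import Function.Bundles using (_⇔_)

Assignment : ℕ → Set
Assignment n = Fin n → Bool

BF : ℕ → Set
BF n = Assignment n → Bool

-- partial assignments: nothing = *
PartialAssignment : ℕ → Set
PartialAssignment n = Fin n → Maybe Bool

Σᶠ : ∀ {n} → (Fin n → ℕ) → ℕ
Σᶠ {zero} v = 0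
Σᶠ {suc n} v = v zero + Σᶠ (λ i → v (suc i))

b2n : Bool → ℕ
b2n true = 1
b2n false = 0

weight : ∀ {n} → Assignment n → ℕ
weight x = Σᶠ (λ i → b2n (x i))

weightOn : ∀ {n} → Subset n → Assignment n → ℕ
weightOn S x = Σᶠ (λ i → b2n (lookup S i ∧ x i))

half : ℕ → ℕ
half n = n / 2

fMaj : (n : ℕ) → BF n
fMaj n x = suc (half n) ≤ᵇ weight x

-- f_S(x) = 1 iff Σ x_i + (1/2k) Σ_{i∈S} x_i ≥ k + 1/2,
-- equivalently (multiplying by 2k > 0, valid for n ≥ 2):
-- 2k·Σ x_i + Σ_{i∈S} x_i ≥ 2k² + k
fSub : (n : ℕ) → Subset n → BF n
fSub n S x = (2 * k * k + k) ≤ᵇ (2 * k * weight x + weightOn S x)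
  where k = half n

_≗ᵇ_ : ∀ {n} → BF n → BF n → Set
g ≗ᵇ h = ∀ x → g x ≡ h x

InK : (n : ℕ) → BF n → Set
InK n g = (g ≗ᵇ fMaj n) ⊎ Σ (Subset n) (λ S → (∣ S ∣ ≡ half n) × (g ≗ᵇ fSub n S))

-- answer: nothing = "yes", just y = counterexample y
ValidEQAnswer : ∀ {n} → BF n → BF n → Maybe (Assignment n) → Set
ValidEQAnswer g h nothing  = g ≗ᵇ h
ValidEQAnswer g h (just y) = g y ≢ h y

-- an algorithm asking a single equivalence query with hypothesis h and
-- then outputting decode(answer); it must be correct for every target in
-- K_n and every valid (possibly adversarial) answer of the oracle
SolvableWithOneEQ : ℕ → Set
SolvableWithOneEQ n =
  Σ (BF n) λ h → Σ (Maybe (Assignment n) → BF n) λ decode →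
    ∀ g → InK n g → ∀ ans → ValidEQAnswer g h ans → decode ans ≗ᵇ g

data Query (n : ℕ) : Set where
  mem : Assignment n → Query n
  sub : PartialAssignment n → Query n

Extends : ∀ {n} → Assignment n → PartialAssignment n → Set
Extends x p = ∀ i b → p i ≡ just b → x i ≡ b

ProjConst : ∀ {n} → BF n → PartialAssignment n → Bool → Set
ProjConst g p c = ∀ x → Extends x p → g x ≡ c

-- correct answer (true = "yes") to a query about target g
Answer : ∀ {n} → BF n → Query n → Bool → Set
Answer g (mem a) b = b ≡ g a
Answer g (sub p) b = (b ≡ true) ⇔ (ProjConst g p false ⊎ ProjConst g p true)

-- deterministic adaptive algorithms = decision trees; a leaf outputs the
-- identified function
data Tree (n : ℕ) : Set where
  leaf : BF n → Tree n
  node : Query n → (Bool → Tree n) → Tree n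

-- Exec g t d o : running t against target g asks d queries and outputs o
data Exec {n : ℕ} (g : BF n) : Tree n → ℕ → BF n → Set where
  done : ∀ o → Exec g (leaf o) 0 o
  step : ∀ {q k b d o} → Answer g q b → Exec g (k b) d o →
         Exec g (node q k) (suc d) o

Identifies : (n : ℕ) → Tree n → Set
Identifies n t = ∀ g → InK n g → ∀ d o → Exec g t d o → o ≗ᵇ g

-- The target f is a strict majority and f_S differs from f only at the indicator
-- vector of S, a point of weight k.  (a) Ask f itself: a counterexample can only
-- be the indicator of S, which names S.  (b) Let the adversary answer every query
-- as f would.  A query can tell f_S from f only if it "probes" the indicator of S:
-- a membership query probes its own point, and a subcube query probes a single
-- point, the top of the subcube when f vanishes on it and the bottom when f is
-- non-constant there (when f is constantly 1 the subcube has no weight-k point).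
-- If the indicator of some k-set S is never probed, the run against f_S coincides
-- with the run against f, so the algorithm outputs the same function for both.
-- Hence all n choose k weight-k vectors are probed, at most one per query.
module Submission where

open import Defs
open import Data.Nat using (ℕ; _≤_; _/_)
open import Data.Nat.Combinatorics using (_C_)
open import Data.Product using (Σ; _×_)

open import Data.Nat using (zero; suc; _+_; _*_; _<_; _≤ᵇ_; z≤n; s≤s; _<?_)
open import Data.Nat.Properties
open import Data.Nat.DivMod using (m≥n⇒m/n>0)
open import Data.Nat.Combinatorics using (nCk+nC[k+1]≡[n+1]C[k+1])
open import Data.Bool using (Bool; true; false; _∧_)
open import Data.Bool.Properties using (T-≡; ¬-not; ∧-idem)
import Data.Bool.Properties as Bool
open import Data.Fin using (Fin; zero; suc)
import Data.Fin.Properties as Fin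
open import Data.Fin.Subset using (Subset; ∣_∣)
open import Data.Maybe using (Maybe; just; nothing; fromMaybe)
open import Data.Product using (_,_; proj₁; proj₂)
open import Data.Sum using (_⊎_; inj₁; inj₂)
open import Data.List using (List; []; _∷_; length; map)
open import Data.List.Properties using (length-map)
open import Data.List.Relation.Unary.Any as Any using (Any; here; there; any?)
open import Data.List.Relation.Unary.Any.Properties using (map⁺)
open import Data.List.Relation.Unary.All as All using (All; []; _∷_)
open import Data.List.Relation.Unary.All.Properties.Core using (¬Any⇒All¬)
open import Data.Vec using ([]; _∷_; tabulate; lookup)
open import Data.Vec.Properties using (lookup∘tabulate)
import Data.Vec.Functional as V
open import Relation.Binary.Definitions using (tri<; tri≈; tri>)
open import Relation.Nullary using (¬_; yes; no; contradiction)
open import Relation.Binary.PropositionalEquality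
open import Function.Bundles using (mk⇔; Equivalence)

≤ᵇ-true : ∀ {m n} → m ≤ n → (m ≤ᵇ n) ≡ true
≤ᵇ-true m≤n = Equivalence.to T-≡ (≤⇒≤ᵇ m≤n)

≤ᵇ-false : ∀ {m n} → n < m → (m ≤ᵇ n) ≡ false
≤ᵇ-false {m} {n} n<m = ¬-not (λ e → <⇒≱ n<m (≤ᵇ⇒≤ m n (Equivalence.from T-≡ e)))

+-≤-tight : ∀ {a b c d} → a ≤ b → c ≤ d → a + c ≡ b + d → a ≡ b × c ≡ d
+-≤-tight {a} {b} {c} {d} a≤b c≤d eq = a≡b , +-cancelˡ-≡ a c d (trans eq (cong (_+ d) (sym a≡b)))
  where
  a≡b : a ≡ b
  a≡b = ≤-antisym a≤b (+-cancelʳ-≤ d b a (subst (_≤ a + d) eq (+-monoʳ-≤ a c≤d)))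

Σᶠ-cong : ∀ {n} {u v : Fin n → ℕ} → (∀ i → u i ≡ v i) → Σᶠ u ≡ Σᶠ v
Σᶠ-cong {zero} _ = refl
Σᶠ-cong {suc n} e = cong₂ _+_ (e zero) (Σᶠ-cong (λ i → e (suc i)))

Σᶠ-mono : ∀ {n} {u v : Fin n → ℕ} → (∀ i → u i ≤ v i) → Σᶠ u ≤ Σᶠ v
Σᶠ-mono {zero} _ = z≤n
Σᶠ-mono {suc n} le = +-mono-≤ (le zero) (Σᶠ-mono (λ i → le (suc i)))

Σᶠ-tight : ∀ {n} {u v : Fin n → ℕ} → (∀ i → u i ≤ v i) → Σᶠ u ≡ Σᶠ v → ∀ i → u i ≡ v i
Σᶠ-tight {suc n} le eq zero = proj₁ (+-≤-tight (le zero) (Σᶠ-mono (λ j → le (suc j))) eq)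
Σᶠ-tight {suc n} le eq (suc i) =
  Σᶠ-tight (λ j → le (suc j)) (proj₂ (+-≤-tight (le zero) (Σᶠ-mono (λ j → le (suc j))) eq)) i

b2n-injective : ∀ {a b} → b2n a ≡ b2n b → a ≡ b
b2n-injective {true} {true} _ = refl
b2n-injective {false} {false} _ = refl

_⊑_ : ∀ {n} → Assignment n → Assignment n → Set
x ⊑ y = ∀ i → b2n (x i) ≤ b2n (y i)

_∧ᵃ_ : ∀ {n} → Assignment n → Assignment n → Assignment n
(x ∧ᵃ y) i = x i ∧ y i

module _ {n : ℕ} {x y : Assignment n} where

  weight-cong : x ≗ y → weight x ≡ weight y
  weight-cong x≗y = Σᶠ-cong (λ i → cong b2n (x≗y i))

  weight-mono : x ⊑ y → weight x ≤ weight y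
  weight-mono = Σᶠ-mono

  weight-tight : x ⊑ y → weight x ≡ weight y → x ≗ y
  weight-tight x⊑y eq i = b2n-injective (Σᶠ-tight x⊑y eq i)

  ∧ᵃ-⊑ˡ : (x ∧ᵃ y) ⊑ x
  ∧ᵃ-⊑ˡ i with x i | y i
  ... | true | true = ≤-refl
  ... | true | false = z≤n
  ... | false | _ = z≤n

  ∧ᵃ-⊑ʳ : (x ∧ᵃ y) ⊑ y
  ∧ᵃ-⊑ʳ i with x i
  ... | true = ≤-refl
  ... | false = z≤n

weight-∧ᵃ-≡⇒≗ : ∀ {n} {x y : Assignment n} →
                weight (x ∧ᵃ y) ≡ weight x → weight (x ∧ᵃ y) ≡ weight y → x ≗ y
weight-∧ᵃ-≡⇒≗ eqˡ eqʳ i = trans (sym (weight-tight ∧ᵃ-⊑ˡ eqˡ i)) (weight-tight ∧ᵃ-⊑ʳ eqʳ i)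

-- weightOn S x is definitionally weight (lookup S ∧ᵃ x).
weightOn≤weight : ∀ {n} (S : Subset n) x → weightOn S x ≤ weight (lookup S)
weightOn≤weight S x = weight-mono (∧ᵃ-⊑ˡ {x = lookup S} {y = x})

∣S∣≡weight : ∀ {n} (S : Subset n) → ∣ S ∣ ≡ weight (lookup S)
∣S∣≡weight [] = refl
∣S∣≡weight (true ∷ S) = cong suc (∣S∣≡weight S)
∣S∣≡weight (false ∷ S) = ∣S∣≡weight S

fSub-cong : ∀ {n} (S T : Subset n) → lookup S ≗ lookup T → fSub n S ≗ᵇ fSub n T
fSub-cong {n} S T S≗T x =
  cong (λ u → (2 * half n * half n + half n) ≤ᵇ (2 * half n * weight x + u))
       (Σᶠ-cong (λ i → cong (λ b → b2n (b ∧ x i)) (S≗T i)))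

-- Lists covering the weight-k vectors

keepIfEq : ∀ {A : Set} → Bool → Bool → A → List A → List A
keepIfEq true true a as = a ∷ as
keepIfEq false false a as = a ∷ as
keepIfEq true false a as = as
keepIfEq false true a as = as

slice : ∀ {n} → Bool → List (Assignment (suc n)) → List (Assignment n)
slice b [] = []
slice b (y ∷ L) = keepIfEq (y zero) b (V.tail y) (slice b L)

slice-length : ∀ {n} (L : List (Assignment (suc n))) →
               length (slice true L) + length (slice false L) ≡ length L
slice-length [] = refl
slice-length (y ∷ L) with y zero
... | true = cong suc (slice-length L)
... | false = trans (+-suc (length (slice true L)) _) (cong suc (slice-length L))

slice-any : ∀ {n} b {x : Assignment n} {L} →
            Any (_≗ b V.∷ x) L → Any (_≗ x) (slice b L)
slice-any b {L = y ∷ L} (here y≗bx) with y zero | y≗bx zero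
... | true | refl = here (λ i → y≗bx (suc i))
... | false | refl = here (λ i → y≗bx (suc i))
slice-any b {L = y ∷ L} (there a) with y zero | b
... | true | true = there (slice-any true a)
... | false | false = there (slice-any false a)
... | true | false = slice-any false a
... | false | true = slice-any true a

Covers : ∀ {n} → ℕ → List (Assignment n) → Set
Covers k L = ∀ x → weight x ≡ k → Any (_≗ x) L

slice-covers : ∀ {n} b {k} (L : List (Assignment (suc n))) →
               Covers (b2n b + k) L → Covers k (slice b L)
slice-covers b L cov x w = slice-any b (cov (b V.∷ x) (cong (b2n b +_) w))

covers-length : ∀ n k (L : List (Assignment n)) → Covers k L → n C k ≤ length L
covers-length zero zero (_ ∷ _) _ = s≤s z≤n
covers-length zero zero [] cov with cov (λ ()) refl
... | ()
covers-length zero (suc k) L _ = z≤n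
covers-length (suc n) zero L cov = begin
  n C 0                  ≤⟨ covers-length n 0 (slice false L) (slice-covers false L cov) ⟩
  length (slice false L) ≤⟨ m≤n+m _ (length (slice true L)) ⟩
  length (slice true L) + length (slice false L) ≡⟨ slice-length L ⟩
  length L               ∎
  where open ≤-Reasoning
covers-length (suc n) (suc k) L cov = begin
  suc n C suc k          ≡⟨ nCk+nC[k+1]≡[n+1]C[k+1] n k ⟨
  n C k + n C suc k      ≤⟨ +-mono-≤ (covers-length n k (slice true L) (slice-covers true L cov))
                                     (covers-length n (suc k) (slice false L) (slice-covers false L cov)) ⟩
  length (slice true L) + length (slice false L) ≡⟨ slice-length L ⟩
  length L               ∎
  where open ≤-Reasoning

top bot : ∀ {n} → PartialAssignment n → Assignment n
top p i = fromMaybe true (p i)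
bot p i = fromMaybe false (p i)

module _ {n : ℕ} {p : PartialAssignment n} where

  top-extends : Extends (top p) p
  top-extends i b pi≡b rewrite pi≡b = refl

  bot-extends : Extends (bot p) p
  bot-extends i b pi≡b rewrite pi≡b = refl

  extends-⊑-top : ∀ {x} → Extends x p → x ⊑ top p
  extends-⊑-top {x} e i with p i | e i
  ... | just b | xi≡ rewrite xi≡ b refl = ≤-refl
  ... | nothing | _ with x i
  ...   | true = ≤-refl
  ...   | false = z≤n

  bot-⊑-extends : ∀ {x} → Extends x p → bot p ⊑ x
  bot-⊑-extends {x} e i with p i | e i
  ... | just b | xi≡ rewrite xi≡ b refl = ≤-refl
  ... | nothing | _ = z≤n

  Answer-constant : ∀ {g : BF n} c → ProjConst g p c → Answer g (sub p) true
  Answer-constant false g≡0 = mk⇔ (λ _ → inj₁ g≡0) (λ _ → refl)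
  Answer-constant true g≡1 = mk⇔ (λ _ → inj₂ g≡1) (λ _ → refl)

  Answer-nonconstant : ∀ {g : BF n} → g (top p) ≡ true → g (bot p) ≡ false → Answer g (sub p) false
  Answer-nonconstant {g} g-top g-bot = mk⇔ (λ ()) constant⇒false≡true
    where
    constant⇒false≡true : ProjConst g p false ⊎ ProjConst g p true → false ≡ true
    constant⇒false≡true (inj₁ g≡0) = trans (sym (g≡0 (top p) top-extends)) g-top
    constant⇒false≡true (inj₂ g≡1) = trans (sym g-bot) (g≡1 (bot p) bot-extends)

-- The threshold of f_S, cleared of the denominator 2k

threshold-above : ∀ k {w u} → k < w → 2 * k * k + k ≤ 2 * k * w + u
threshold-above k {w} {u} k<w = begin
  2 * k * k + k      ≤⟨ +-monoʳ-≤ (2 * k * k) (m≤m+n k (k + 0)) ⟩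
  2 * k * k + 2 * k  ≡⟨ +-comm (2 * k * k) (2 * k) ⟩
  2 * k + 2 * k * k  ≡⟨ *-suc (2 * k) k ⟨
  2 * k * suc k      ≤⟨ *-monoʳ-≤ (2 * k) k<w ⟩
  2 * k * w          ≤⟨ m≤m+n (2 * k * w) u ⟩
  2 * k * w + u      ∎
  where open ≤-Reasoning

threshold-below : ∀ k {w u} → 1 ≤ k → w < k → u ≤ k → 2 * k * w + u < 2 * k * k + k
threshold-below k {w} {u} 1≤k w<k u≤k = begin-strict
  2 * k * w + u      ≤⟨ +-monoʳ-≤ (2 * k * w) u≤k ⟩
  2 * k * w + k      <⟨ +-monoʳ-< (2 * k * w) (m<m+n k (≤-trans 1≤k (m≤m+n k 0))) ⟩
  2 * k * w + 2 * k  ≡⟨ +-comm (2 * k * w) (2 * k) ⟩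
  2 * k + 2 * k * w  ≡⟨ *-suc (2 * k) w ⟨
  2 * k * suc w      ≤⟨ *-monoʳ-≤ (2 * k) w<k ⟩
  2 * k * k          ≤⟨ m≤m+n (2 * k * k) k ⟩
  2 * k * k + k      ∎
  where open ≤-Reasoning

module Identification (n : ℕ) (1≤k : 1 ≤ half n) where

  k : ℕ
  k = half n

  f : BF n
  f = fMaj n

  fMaj-above : ∀ {x} → k < weight x → f x ≡ true
  fMaj-above = ≤ᵇ-true

  fMaj-atMost : ∀ {x} → weight x ≤ k → f x ≡ false
  fMaj-atMost w≤k = ≤ᵇ-false (s≤s w≤k)

  module _ (S : Subset n) (wS : weight (lookup S) ≡ k) where

    heavy-≉ : ∀ {x} → k < weight x → ¬ (x ≗ lookup S)
    heavy-≉ k<w x≗S = <-irrefl (sym (trans (weight-cong x≗S) wS)) k<w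

    fSub-agrees : ∀ {x} → ¬ (x ≗ lookup S) → fSub n S x ≡ f x
    fSub-agrees {x} x≉S with <-cmp (weight x) k
    ... | tri< w<k _ _ =
      trans (≤ᵇ-false (threshold-below k 1≤k w<k overlap≤k)) (sym (fMaj-atMost (<⇒≤ w<k)))
      where
      overlap≤k : weightOn S x ≤ k
      overlap≤k = ≤-trans (weightOn≤weight S x) (≤-reflexive wS)
    ... | tri> _ _ k<w = trans (≤ᵇ-true (threshold-above k k<w)) (sym (fMaj-above k<w))
    ... | tri≈ _ w≡k _ with weightOn S x <? k
    ...   | yes overlap<k = trans (≤ᵇ-false below) (sym (fMaj-atMost (≤-reflexive w≡k)))
      where
      below : 2 * k * weight x + weightOn S x < 2 * k * k + k
      below = subst (λ w → 2 * k * w + weightOn S x < 2 * k * k + k) (sym w≡k)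
                    (+-monoʳ-< (2 * k * k) overlap<k)
    ...   | no overlap≮k = contradiction (λ i → sym (S≗x i)) x≉S
      where
      overlap≡k : weightOn S x ≡ k
      overlap≡k = ≤-antisym (≤-trans (weightOn≤weight S x) (≤-reflexive wS)) (≮⇒≥ overlap≮k)
      S≗x : lookup S ≗ x
      S≗x = weight-∧ᵃ-≡⇒≗ {x = lookup S} {y = x}
              (trans overlap≡k (sym wS)) (trans overlap≡k (sym w≡k))

    fSub-indicator : fSub n S (lookup S) ≡ true
    fSub-indicator = ≤ᵇ-true (≤-reflexive (cong₂ _+_ (cong (2 * k *_) (sym wS)) (sym overlap≡k)))
      where
      overlap≡k : weightOn S (lookup S) ≡ k
      overlap≡k = trans (weight-cong (λ i → ∧-idem (lookup S i))) wS

    fSub-≢-at-indicator : fSub n S (lookup S) ≢ f (lookup S)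
    fSub-≢-at-indicator e with trans (sym fSub-indicator) (trans e (fMaj-atMost (≤-reflexive wS)))
    ... | ()

    fSub-differs : ∀ {x} → fSub n S x ≢ f x → x ≗ lookup S
    fSub-differs {x} fSx≢fx with Fin.all? (λ i → x i Bool.≟ lookup S i)
    ... | yes x≗S = x≗S
    ... | no x≉S = contradiction (fSub-agrees x≉S) fSx≢fx

  oneEQ : SolvableWithOneEQ n
  oneEQ = f , decode , decode-correct
    where
    decode : Maybe (Assignment n) → BF n
    decode nothing = f
    decode (just y) = fSub n (tabulate y)

    decode-correct : ∀ g → InK n g → ∀ ans → ValidEQAnswer g f ans → decode ans ≗ᵇ g
    decode-correct g _ nothing g≗f x = sym (g≗f x)
    decode-correct g (inj₁ g≗f) (just y) gy≢fy = contradiction (g≗f y) gy≢fy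
    decode-correct g (inj₂ (S , ∣S∣≡k , g≗fS)) (just y) gy≢fy x =
      trans (fSub-cong (tabulate y) S y≗S x) (sym (g≗fS x))
      where
      wS : weight (lookup S) ≡ k
      wS = trans (sym (∣S∣≡weight S)) ∣S∣≡k
      y≗S : lookup (tabulate y) ≗ lookup S
      y≗S i = trans (lookup∘tabulate y i) (fSub-differs S wS (λ e → gy≢fy (trans (g≗fS y) e)) i)

  data Shape (p : PartialAssignment n) : Set where
    vanishing : weight (top p) ≤ k → Shape p
    full      : k < weight (bot p) → Shape p
    mixed     : k < weight (top p) → weight (bot p) ≤ k → Shape p

  shape : ∀ p → Shape p
  shape p with weight (top p) ≤? k | k <? weight (bot p)
  ... | yes t≤k | _ = vanishing t≤k
  ... | no t≰k | yes k<b = full k<b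
  ... | no t≰k | no k≮b = mixed (≰⇒> t≰k) (≮⇒≥ k≮b)

  isConstant : ∀ {p} → Shape p → Bool
  isConstant (mixed _ _) = false
  isConstant _ = true

  probeSub : ∀ {p} → Shape p → Assignment n
  probeSub {p} (vanishing _) = top p
  probeSub {p} _ = bot p  -- in the full case there is no weight-k point to probe

  reply : Query n → Bool
  reply (mem a) = f a
  reply (sub p) = isConstant (shape p)

  probe : Query n → Assignment n
  probe (mem a) = a
  probe (sub p) = probeSub (shape p)

  reply-fMaj : ∀ q → Answer f q (reply q)
  reply-fMaj (mem a) = refl
  reply-fMaj (sub p) with shape p
  ... | vanishing t≤k =
    Answer-constant false (λ x e → fMaj-atMost (≤-trans (weight-mono (extends-⊑-top e)) t≤k))
  ... | full k<b =
    Answer-constant true (λ x e → fMaj-above (<-≤-trans k<b (weight-mono (bot-⊑-extends e))))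
  ... | mixed k<t b≤k = Answer-nonconstant (fMaj-above k<t) (fMaj-atMost b≤k)

  reply-fSub : ∀ S → weight (lookup S) ≡ k →
               ∀ q → ¬ (probe q ≗ lookup S) → Answer (fSub n S) q (reply q)
  reply-fSub S wS (mem a) a≉S = sym (fSub-agrees S wS a≉S)
  reply-fSub S wS (sub p) probe≉S with shape p
  ... | vanishing t≤k =
    Answer-constant false (λ x e → trans (fSub-agrees S wS (x≉S e)) (fMaj-atMost (x≤k e)))
    where
    -- an extension of weight k ≥ weight (top p) is top p itself
    x≉S : ∀ {x} → Extends x p → ¬ (x ≗ lookup S)
    x≉S {x} e x≗S = probe≉S (λ i → trans (sym (x≗top i)) (x≗S i))
      where
      x≗top : x ≗ top p
      x≗top = weight-tight (extends-⊑-top e)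
                (≤-antisym (weight-mono (extends-⊑-top e))
                           (≤-trans t≤k (≤-reflexive (sym (trans (weight-cong x≗S) wS)))))
    x≤k : ∀ {x} → Extends x p → weight x ≤ k
    x≤k e = ≤-trans (weight-mono (extends-⊑-top e)) t≤k
  ... | full k<b =
    Answer-constant true (λ x e → trans (fSub-agrees S wS (heavy-≉ S wS (k<x e))) (fMaj-above (k<x e)))
    where
    k<x : ∀ {x} → Extends x p → k < weight x
    k<x e = <-≤-trans k<b (weight-mono (bot-⊑-extends e))
  ... | mixed k<t b≤k =
    Answer-nonconstant (trans (fSub-agrees S wS (heavy-≉ S wS k<t)) (fMaj-above k<t))
                       (trans (fSub-agrees S wS probe≉S) (fMaj-atMost b≤k))

  queries : Tree n → List (Query n)
  queries (leaf _) = []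
  queries (node q next) = q ∷ queries (next (reply q))

  output : Tree n → BF n
  output (leaf o) = o
  output (node q next) = output (next (reply q))

  run : ∀ {g} t → All (λ q → Answer g q (reply q)) (queries t) →
        Exec g t (length (queries t)) (output t)
  run (leaf o) [] = done o
  run (node q next) (a ∷ as) = step a (run (next (reply q)) as)

  run-fMaj : ∀ t → Exec f t (length (queries t)) (output t)
  run-fMaj t = run t (All.universal reply-fMaj (queries t))

  run-fSub : ∀ S → weight (lookup S) ≡ k → ∀ t → All (λ q → ¬ (probe q ≗ lookup S)) (queries t) →
             Exec (fSub n S) t (length (queries t)) (output t)
  run-fSub S wS t unprobed = run t (All.map (reply-fSub S wS _) unprobed)

  probes-cover : ∀ t → Identifies n t → Covers k (map probe (queries t))
  probes-cover t identifies s ws = map⁺ (Any.map (λ q≗S i → trans (q≗S i) (S≗s i)) probed)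
    where
    S : Subset n
    S = tabulate s
    S≗s : lookup S ≗ s
    S≗s = lookup∘tabulate s
    wS : weight (lookup S) ≡ k
    wS = trans (weight-cong S≗s) ws
    probed : Any (λ q → probe q ≗ lookup S) (queries t)
    probed with any? (λ q → Fin.all? (λ i → probe q i Bool.≟ lookup S i)) (queries t)
    ... | yes some = some
    ... | no none =
      contradiction (trans (sym (output≗fS (lookup S))) (output≗f (lookup S))) (fSub-≢-at-indicator S wS)
      where
      output≗fS : output t ≗ᵇ fSub n S
      output≗fS = identifies (fSub n S) (inj₂ (S , trans (∣S∣≡weight S) wS , λ _ → refl)) _ _
                    (run-fSub S wS t (¬Any⇒All¬ _ none))
      output≗f : output t ≗ᵇ f
      output≗f = identifies f (inj₁ (λ _ → refl)) _ _ (run-fMaj t)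

  lowerBound : (t : Tree n) → Identifies n t →
    Σ (BF n) λ g → InK n g × Σ ℕ λ d → Σ (BF n) λ o → Exec g t d o × (n C k) ≤ d
  lowerBound t identifies =
    f , inj₁ (λ _ → refl) , length (queries t) , output t , run-fMaj t ,
    subst (n C k ≤_) (length-map probe (queries t)) (covers-length n k _ (probes-cover t identifies))

lemma2 : (n : ℕ) → 2 ≤ n →
    SolvableWithOneEQ n ×
    ((t : Tree n) → Identifies n t →
      Σ (BF n) λ g → InK n g × Σ ℕ λ d → Σ (BF n) λ o →
        Exec g t d o × (n C (n / 2)) ≤ d)
lemma2 n 2≤n = oneEQ , lowerBound
  where open Identification n (m≥n⇒m/n>0 2≤n)
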